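{- Let $n\ge 1$. There is a bijection $\phi:\mathcal{T}_n\to \mathcal{RS}_n$ such that every tree $T\in\mathcal{T}_n$ with $k+1$ leaves is mapped to a permutation $\phi(T)\in\mathcal{RS}_n$ with exactly $k$ descents.
   Context: For $\sigma=\sigma_1\cdots\sigma_n\in\mathfrak{S}_n$, a descent is an index $i$ ($1\le i\le n-1$) with $\sigma_i>\sigma_{i+1}$, and a double descent is an index $i$ ($1\le i\le n-2$) with $\sigma_i>\sigma_{i+1}>\sigma_{i+2}$. The permutation $\sigma$ is simsun if for every $k$, the subword of $\sigma$ consisting of the letters in $\{1,\dots,k\}$ (in the order they appear in $\sigma$) has no double descent. $\mathcal{RS}_n$ denotes the set of simsun permutations in $\mathfrak{S}_n$. A rooted tree on vertex set $\{0,1,\dots,n\}$ with root $0$ is increasing if every path starting at the root has increasing labels. $\mathcal{T}_n$ is the set of increasing trees on $\{0,1,\dots,n\}$ rooted at $0$ in which every vertex has at most two children, where the order of the children (subtrees) of a vertex is irrelevant (increasing 1-2 trees). A leaf is a vertex with no children. -}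

module Defs where

open import Data.Nat using (ℕ; zero; suc; _≤_; _<_; _>_; _≤?_; _<?_; _≟_)
open import Data.List using (List; []; _∷_; length; filter; map; upTo)
open import Data.List.Relation.Binary.Permutation.Propositional using (_↭_)
open import Data.Product using (_×_)
open import Data.Unit using (⊤)
open import Relation.Nullary using (¬_; yes; no)
open import Relation.Binary.PropositionalEquality using (_≡_)

oneTo : ℕ → List ℕ
oneTo n = map suc (upTo n)

IsPerm : ℕ → List ℕ → Set
IsPerm n σ = σ ↭ oneTo n

des : List ℕ → ℕ
desFrom : ℕ → List ℕ → ℕ
des [] = 0
des (a ∷ l) = desFrom a l
desFrom a [] = 0
desFrom a (b ∷ l) with b <? a
... | yes _ = suc (desFrom b l)
... | no _ = desFrom b l

data HasDD : List ℕ → Set where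
  here  : ∀ {a b c l} → a > b → b > c → HasDD (a ∷ b ∷ c ∷ l)
  there : ∀ {x l} → HasDD l → HasDD (x ∷ l)

restrict : ℕ → List ℕ → List ℕ
restrict k σ = filter (_≤? k) σ

Simsun : List ℕ → Set
Simsun σ = ∀ k → ¬ HasDD (restrict k σ)

-- Increasing 1-2 trees on {0,…,n} rooted at 0 (children unordered).
-- Such a tree is determined by its parent function: a list p = p₁ ⋯ pₙ
-- where pᵢ is the parent of vertex i; increasing means pᵢ < i.

-- pᵢ ≤ i - 1 for each position (k counts the current vertex minus one)
ParentsBelow : ℕ → List ℕ → Set
ParentsBelow k [] = ⊤
ParentsBelow k (x ∷ xs) = x ≤ k × ParentsBelow (suc k) xs

children : List ℕ → ℕ → ℕ
children p v = length (filter (v ≟_) p)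

Is12Tree : ℕ → List ℕ → Set
Is12Tree n p = length p ≡ n × ParentsBelow 0 p × (∀ v → children p v ≤ 2)

leaves : ℕ → List ℕ → ℕ
leaves n p = length (filter (λ v → children p v ≟ 0) (upTo (suc n)))

-- The proof uses generating trees.  Both families grow one element at a
-- time, and every object of size m+1 arises from a unique object of size m:
--   * a tree on {0,…,m+1} by attaching the vertex m+1 to a vertex of the
--     tree on {0,…,m} with fewer than two children;
--   * a simsun permutation of [m+1] by inserting the letter m+1 into a slot
--     of a simsun permutation of [m] that does not precede a descent.
-- In both cases the admissible places ("sites") are of two kinds: `stat`
-- many of them keep the statistic (#leaves, resp. #descents + 1), and
-- m + 2 - 2·stat of them raise it by one.  Listing the sites in a canonical
-- order, an object of size n is encoded by the sequence of site indices
-- chosen while growing it, and the set of valid codes together with the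
-- statistic along a code depends only on these numbers.
module Submission where

open import Defs
open import Data.Bool using (Bool; true; false; _∧_; _∨_; not)
open import Data.Bool.Properties using (T-≡)
open import Data.Empty using (⊥; ⊥-elim)
open import Data.List using (List; []; _∷_; [_]; length; filter; map; upTo; applyUpTo; _++_; reverse)
open import Data.List.Membership.Propositional using (_∈_; _∉_)
open import Data.List.Membership.Propositional.Properties
  using (∈-++⁺ˡ; ∈-++⁺ʳ; ∈-++⁻; ∈-filter⁺; ∈-filter⁻; ∈-upTo⁺; ∈-upTo⁻; ∈-map⁺; ∈-map⁻)
open import Data.List.Properties
  using (length-++; length-map; length-upTo; map-++; upTo-∷ʳ; filter-accept; filter-reject; filter-all; filter-≐;
         unfold-reverse; length-reverse; reverse-involutive; reverse-injective)
open import Data.List.Relation.Binary.Permutation.Propositional using (_↭_; prep; swap; ↭-refl; ↭-sym; ↭-trans)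
open import Data.List.Relation.Binary.Permutation.Propositional.Properties
  using (All-resp-↭; ∈-resp-↭; drop-∷; ↭-length; ∷↭∷ʳ; ↭-reverse; filter-↭)
open import Data.List.Relation.Unary.All using (All; []; _∷_)
import Data.List.Relation.Unary.All as All
open import Data.List.Relation.Unary.AllPairs using (_∷_)
open import Data.List.Relation.Unary.Any using (here; there)
open import Data.List.Relation.Unary.Unique.Propositional using (Unique)
import Data.List.Relation.Unary.Unique.Propositional.Properties as Unique
open import Data.Nat using (ℕ; zero; suc; _+_; _≤_; _<_; _≟_; _<?_; _≤?_; z≤n; s≤s)
open import Data.Nat.Properties
open import Data.Nat.Tactic.RingSolver using (solve-∀)
open import Data.Product using (Σ; ∃; _×_; _,_; proj₁; proj₂)
open import Data.Sum using (_⊎_; inj₁; inj₂)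
import Data.Sum
open import Data.Unit using (⊤; tt)
open import Function.Bundles using (Equivalence)
open import Relation.Nullary using (¬_; Dec; yes; no; does)
open import Relation.Nullary.Decidable using (T?; dec-true; dec-false)
open import Relation.Unary using (Decidable)
open import Relation.Binary.PropositionalEquality
  using (_≡_; _≢_; refl; sym; trans; cong; cong₂; subst; subst₂; module ≡-Reasoning)

module Positions where

  -- the c-th entry of a list (0 when out of range)
  nth : List ℕ → ℕ → ℕ
  nth []       _       = 0
  nth (x ∷ xs) zero    = x
  nth (x ∷ xs) (suc c) = nth xs c

  -- the position of the first occurrence of x (the length when absent)
  position : ℕ → List ℕ → ℕ
  position x [] = 0
  position x (a ∷ l) with a ≟ x
  ... | yes _ = 0
  ... | no  _ = suc (position x l)

  nth-∈ : ∀ xs c → c < length xs → nth xs c ∈ xs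
  nth-∈ (x ∷ xs) zero    _       = here refl
  nth-∈ (x ∷ xs) (suc c) (s≤s p) = there (nth-∈ xs c p)

  nth-position : ∀ {x} xs → x ∈ xs → nth xs (position x xs) ≡ x
  nth-position {x} (a ∷ l) m with a ≟ x
  nth-position {x} (a ∷ l) m         | yes a≡x = a≡x
  nth-position {x} (a ∷ l) (here x≡a) | no  a≢x = ⊥-elim (a≢x (sym x≡a))
  nth-position {x} (a ∷ l) (there m)  | no  _   = nth-position l m

  position-< : ∀ {x} xs → x ∈ xs → position x xs < length xs
  position-< {x} (a ∷ l) m with a ≟ x
  position-< {x} (a ∷ l) m         | yes _   = s≤s z≤n
  position-< {x} (a ∷ l) (here x≡a) | no  a≢x = ⊥-elim (a≢x (sym x≡a))
  position-< {x} (a ∷ l) (there m)  | no  _   = s≤s (position-< l m)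

  position-nth : ∀ xs c → Unique xs → c < length xs → position (nth xs c) xs ≡ c
  position-nth (a ∷ l) zero u p with a ≟ a
  ... | yes _   = refl
  ... | no  a≢a = ⊥-elim (a≢a refl)
  position-nth (a ∷ l) (suc c) (a∉l ∷ u) (s≤s p) with a ≟ nth l c
  ... | yes a≡ = ⊥-elim (All.lookup a∉l (nth-∈ l c p) a≡)
  ... | no  _  = cong suc (position-nth l c u p)

  nth-++ : ∀ xs ys c → c < length xs + length ys →
    (c < length xs × nth (xs ++ ys) c ∈ xs) ⊎ (length xs ≤ c × nth (xs ++ ys) c ∈ ys)
  nth-++ []       ys c       p       = inj₂ (z≤n , nth-∈ ys c p)
  nth-++ (x ∷ xs) ys zero    p       = inj₁ (s≤s z≤n , here refl)
  nth-++ (x ∷ xs) ys (suc c) (s≤s p) with nth-++ xs ys c p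
  ... | inj₁ (c< , m) = inj₁ (s≤s c< , there m)
  ... | inj₂ (≤c , m) = inj₂ (s≤s ≤c , m)

module Counting where

  bit : Bool → ℕ
  bit true  = 1
  bit false = 0

  count : (ℕ → Bool) → ℕ → ℕ
  count f zero    = 0
  count f (suc N) = bit (f N) + count f N

  count-suc : ∀ f N → count f (suc N) ≡ bit (f 0) + count (λ i → f (suc i)) N
  count-suc f zero    = refl
  count-suc f (suc N) = begin
      bit (f (suc N)) + count f (suc N)
    ≡⟨ cong (bit (f (suc N)) +_) (count-suc f N) ⟩
      bit (f (suc N)) + (bit (f 0) + count g N)
    ≡⟨ swap-front (bit (f (suc N))) (bit (f 0)) (count g N) ⟩
      bit (f 0) + (bit (f (suc N)) + count g N)
    ∎
    where
    open ≡-Reasoning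
    g : ℕ → Bool
    g i = f (suc i)
    swap-front : ∀ a b c → a + (b + c) ≡ b + (a + c)
    swap-front = solve-∀

  count-filter : ∀ {P : ℕ → Set} (P? : Decidable P) g N →
    length (filter P? (applyUpTo g N)) ≡ count (λ i → does (P? (g i))) N
  count-filter P? g zero    = refl
  count-filter P? g (suc N) rewrite count-suc (λ i → does (P? (g i))) N with P? (g 0)
  ... | yes _ = cong suc (count-filter P? (λ i → g (suc i)) N)
  ... | no  _ = count-filter P? (λ i → g (suc i)) N

  count-cong : ∀ f g N → (∀ i → i < N → f i ≡ g i) → count f N ≡ count g N
  count-cong f g zero    _ = refl
  count-cong f g (suc N) h =
    cong₂ _+_ (cong bit (h N ≤-refl)) (count-cong f g N (λ i i<N → h i (m≤n⇒m≤1+n i<N)))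

  count-none : ∀ f N → (∀ i → i < N → f i ≡ false) → count f N ≡ 0
  count-none f zero    _ = refl
  count-none f (suc N) h rewrite h N ≤-refl = count-none f N (λ i i<N → h i (m≤n⇒m≤1+n i<N))

  count-update : ∀ f g N s → s < N → (∀ i → i < N → i ≢ s → f i ≡ g i) →
    count f N + bit (g s) ≡ count g N + bit (f s)
  count-update f g (suc N) s s<N h with s ≟ N
  ... | yes refl rewrite count-cong f g N (λ i i<N → h i (m≤n⇒m≤1+n i<N) (λ i≡N → <-irrefl i≡N i<N)) =
    rotate (bit (f s)) (count g s) (bit (g s))
    where
    rotate : ∀ a b c → a + b + c ≡ c + b + a
    rotate = solve-∀
  ... | no  s≢N rewrite h N ≤-refl (λ N≡s → s≢N (sym N≡s)) = begin
      bit (g N) + count f N + bit (g s)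
    ≡⟨ +-assoc (bit (g N)) _ _ ⟩
      bit (g N) + (count f N + bit (g s))
    ≡⟨ cong (bit (g N) +_) (count-update f g N s (≤∧≢⇒< (≤-pred s<N) s≢N) (λ i i<N → h i (m≤n⇒m≤1+n i<N))) ⟩
      bit (g N) + (count g N + bit (f s))
    ≡⟨ +-assoc (bit (g N)) _ _ ⟨
      bit (g N) + count g N + bit (f s)
    ∎
    where open ≡-Reasoning

  count-∨ : ∀ f g N → count (λ i → f i ∨ g i) N + count (λ i → f i ∧ g i) N ≡ count f N + count g N
  count-∨ f g zero    = refl
  count-∨ f g (suc N) = begin
      (bit (f N ∨ g N) + count f∨g N) + (bit (f N ∧ g N) + count f∧g N)
    ≡⟨ interchange (bit (f N ∨ g N)) _ _ _ ⟩
      (bit (f N ∨ g N) + bit (f N ∧ g N)) + (count f∨g N + count f∧g N)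
    ≡⟨ cong₂ _+_ (bits (f N) (g N)) (count-∨ f g N) ⟩
      (bit (f N) + bit (g N)) + (count f N + count g N)
    ≡⟨ interchange (bit (f N)) _ _ _ ⟨
      (bit (f N) + count f N) + (bit (g N) + count g N)
    ∎
    where
    open ≡-Reasoning
    f∨g f∧g : ℕ → Bool
    f∨g i = f i ∨ g i
    f∧g i = f i ∧ g i
    interchange : ∀ a b c d → (a + b) + (c + d) ≡ (a + c) + (b + d)
    interchange = solve-∀
    bits : ∀ p q → bit (p ∨ q) + bit (p ∧ q) ≡ bit p + bit q
    bits true  true  = refl
    bits true  false = refl
    bits false true  = refl
    bits false false = refl

  count-neither : ∀ f g N →
    count (λ i → not (f i) ∧ not (g i)) N + (count f N + count g N) ≡ N + count (λ i → f i ∧ g i) N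
  count-neither f g zero    = refl
  count-neither f g (suc N) = begin
      (bit (nor N) + count nor N) + ((bit (f N) + count f N) + (bit (g N) + count g N))
    ≡⟨ regroup (bit (nor N)) _ (bit (f N)) _ (bit (g N)) _ ⟩
      (bit (nor N) + (bit (f N) + bit (g N))) + (count nor N + (count f N + count g N))
    ≡⟨ cong₂ _+_ (bits (f N) (g N)) (count-neither f g N) ⟩
      (1 + bit (f N ∧ g N)) + (N + count (λ i → f i ∧ g i) N)
    ≡⟨ interchange 1 (bit (f N ∧ g N)) N (count (λ i → f i ∧ g i) N) ⟩
      suc N + (bit (f N ∧ g N) + count (λ i → f i ∧ g i) N)
    ∎
    where
    open ≡-Reasoning
    nor : ℕ → Bool
    nor i = not (f i) ∧ not (g i)
    regroup : ∀ n A a C b D → (n + A) + ((a + C) + (b + D)) ≡ (n + (a + b)) + (A + (C + D))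
    regroup = solve-∀
    interchange : ∀ a b c d → (a + b) + (c + d) ≡ (a + c) + (b + d)
    interchange = solve-∀
    bits : ∀ p q → bit (not p ∧ not q) + (bit p + bit q) ≡ 1 + bit (p ∧ q)
    bits true  true  = refl
    bits true  false = refl
    bits false true  = refl
    bits false false = refl

module Growth where

  open Positions

  record GrowthRule : Set₁ where
    field
      Ok          : List ℕ → Set
      stat        : List ℕ → ℕ
      keep raise  : List ℕ → List ℕ
      grow        : List ℕ → ℕ → List ℕ
      parent      : List ℕ → List ℕ
      lastSite    : List ℕ → ℕ
      ok-[]       : Ok []
      stat-[]     : stat [] ≡ 1
      length-keep : ∀ {x} → Ok x → length (keep x) ≡ stat x
      site-count  : ∀ {x} → Ok x → length (raise x) + (stat x + stat x) ≡ suc (suc (length x))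
      sites-unique : ∀ {x} → Ok x → Unique (keep x ++ raise x)
      grow-ok     : ∀ {x s} → Ok x → s ∈ keep x ++ raise x → Ok (grow x s)
      grow-length : ∀ {x s} → Ok x → s ∈ keep x ++ raise x → length (grow x s) ≡ suc (length x)
      parent-grow : ∀ {x s} → Ok x → s ∈ keep x ++ raise x → parent (grow x s) ≡ x
      lastSite-grow : ∀ {x s} → Ok x → s ∈ keep x ++ raise x → lastSite (grow x s) ≡ s
      stat-keep   : ∀ {x s} → Ok x → s ∈ keep x → stat (grow x s) ≡ stat x
      stat-raise  : ∀ {x s} → Ok x → s ∈ raise x → stat (grow x s) ≡ suc (stat x)
      shrink      : ∀ {y} → Ok y → 0 < length y →
        Ok (parent y) × lastSite y ∈ keep (parent y) ++ raise (parent y) × grow (parent y) (lastSite y) ≡ y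

  -- The statistic along a code (read newest choice first): site c among
  -- the sites keep ++ raise keeps the statistic l exactly when c < l.
  nextStat : ℕ → ℕ → ℕ
  nextStat c l with c <? l
  ... | yes _ = l
  ... | no  _ = suc l

  nextStat-keep : ∀ {c l} → c < l → nextStat c l ≡ l
  nextStat-keep {c} {l} c<l with c <? l
  ... | yes _   = refl
  ... | no  c≮l = ⊥-elim (c≮l c<l)

  nextStat-raise : ∀ {c l} → l ≤ c → nextStat c l ≡ suc l
  nextStat-raise {c} {l} l≤c with c <? l
  ... | yes c<l = ⊥-elim (<⇒≱ c<l l≤c)
  ... | no  _   = refl

  codeStat : List ℕ → ℕ
  codeStat []       = 1
  codeStat (c ∷ cs) = nextStat c (codeStat cs)

  -- each entry indexes one of the m + 2 - stat sites available at that point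
  ValidCode : List ℕ → Set
  ValidCode []       = ⊤
  ValidCode (c ∷ cs) = ValidCode cs × c + codeStat cs < suc (suc (length cs))

  module Codes (R : GrowthRule) where
    open GrowthRule R

    sites : List ℕ → List ℕ
    sites x = keep x ++ raise x

    decode : List ℕ → List ℕ
    decode []       = []
    decode (c ∷ cs) = grow (decode cs) (nth (sites (decode cs)) c)

    encode : ℕ → List ℕ → List ℕ
    encode zero    y = []
    encode (suc m) y = position (lastSite y) (sites (parent y)) ∷ encode m (parent y)

    length-encode : ∀ m y → length (encode m y) ≡ m
    length-encode zero    y = refl
    length-encode (suc m) y = cong suc (length-encode m (parent y))

    length-sites : ∀ {x} → Ok x → length (sites x) + stat x ≡ suc (suc (length x))
    length-sites {x} ok = begin
        length (keep x ++ raise x) + stat x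
      ≡⟨ cong (_+ stat x) (length-++ (keep x)) ⟩
        (length (keep x) + length (raise x)) + stat x
      ≡⟨ cong (λ k → (k + length (raise x)) + stat x) (length-keep ok) ⟩
        (stat x + length (raise x)) + stat x
      ≡⟨ regroup (stat x) (length (raise x)) ⟩
        length (raise x) + (stat x + stat x)
      ≡⟨ site-count ok ⟩
        suc (suc (length x))
      ∎
      where
      open ≡-Reasoning
      regroup : ∀ a b → (a + b) + a ≡ b + (a + a)
      regroup = solve-∀

    site-index⁺ : ∀ {x c} → Ok x → c + stat x < suc (suc (length x)) → c < length (sites x)
    site-index⁺ {x} {c} ok bd = +-cancelʳ-< (stat x) c _ (subst (c + stat x <_) (sym (length-sites ok)) bd)

    site-index⁻ : ∀ {x c} → Ok x → c < length (sites x) → c + stat x < suc (suc (length x))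
    site-index⁻ {x} {c} ok c< = subst (c + stat x <_) (length-sites ok) (+-monoˡ-< (stat x) c<)

    use-site : ∀ {x c} → Ok x → c < length (sites x) →
      nth (sites x) c ∈ sites x × stat (grow x (nth (sites x) c)) ≡ nextStat c (stat x)
    use-site {x} {c} ok c< with nth-++ (keep x) (raise x) c (subst (c <_) (length-++ (keep x)) c<)
    ... | inj₁ (c<k , m) =
      ∈-++⁺ˡ m , trans (stat-keep ok m) (sym (nextStat-keep (subst (c <_) (length-keep ok) c<k)))
    ... | inj₂ (k≤c , m) =
      ∈-++⁺ʳ (keep x) m , trans (stat-raise ok m) (sym (nextStat-raise (subst (_≤ c) (length-keep ok) k≤c)))

    entry-in-range : ∀ {c cs} → c + codeStat cs < suc (suc (length cs)) → Ok (decode cs) →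
      length (decode cs) ≡ length cs → stat (decode cs) ≡ codeStat cs → c < length (sites (decode cs))
    entry-in-range {c} bd ok len st = site-index⁺ ok (subst₂ (λ l m → c + l < suc (suc m)) (sym st) (sym len) bd)

    decode-valid : ∀ cs → ValidCode cs →
      Ok (decode cs) × length (decode cs) ≡ length cs × stat (decode cs) ≡ codeStat cs
    decode-valid []       _         = ok-[] , refl , stat-[]
    decode-valid (c ∷ cs) (vc , bd) with decode-valid cs vc
    ... | ok , len , st with use-site ok (entry-in-range {c} {cs} bd ok len st)
    ... | m , st′ = grow-ok ok m , trans (grow-length ok m) (cong suc len) , trans st′ (cong (nextStat c) st)

    -- undoing the last growth step recovers the last entry, since sites are distinct
    encode-decode : ∀ cs → ValidCode cs → encode (length cs) (decode cs) ≡ cs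
    encode-decode []       _         = refl
    encode-decode (c ∷ cs) (vc , bd) with decode-valid cs vc
    ... | ok , len , st with entry-in-range {c} {cs} bd ok len st
    ... | c< rewrite parent-grow ok (proj₁ (use-site ok c<)) | lastSite-grow ok (proj₁ (use-site ok c<))
                   | encode-decode cs vc
      = cong (_∷ cs) (position-nth (sites (decode cs)) c (sites-unique ok) c<)

    decode-encode : ∀ m y → Ok y → length y ≡ m → ValidCode (encode m y) × decode (encode m y) ≡ y
    decode-encode zero    []  _  _   = tt , refl
    decode-encode (suc m) y   ok len with shrink ok (subst (0 <_) (sym len) (s≤s z≤n))
    ... | ok′ , s∈ , regrow with decode-encode m (parent y) ok′ len′
      where
      len′ : length (parent y) ≡ m
      len′ = suc-injective (trans (sym (grow-length ok′ s∈)) (trans (cong length regrow) len))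
    ... | vc , de = (vc , bd) , (begin
        grow (decode cs) (nth (sites (decode cs)) c)
      ≡⟨ cong (λ z → grow z (nth (sites z) c)) de ⟩
        grow x (nth (sites x) c)
      ≡⟨ cong (grow x) (nth-position (sites x) s∈) ⟩
        grow x (lastSite y)
      ≡⟨ regrow ⟩
        y
      ∎)
      where
      open ≡-Reasoning
      x = parent y
      cs = encode m x
      c = position (lastSite y) (sites x)
      bd : c + codeStat cs < suc (suc (length cs))
      bd = subst₂ (λ l k → c + l < suc (suc k))
             (trans (cong stat (sym de)) (proj₂ (proj₂ (decode-valid cs vc))))
             (trans (cong length (sym de)) (proj₁ (proj₂ (decode-valid cs vc))))
             (site-index⁻ ok′ (position-< (sites x) s∈))

  module Transfer (S T : GrowthRule) where
    private
      module S = GrowthRule S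
      module T = GrowthRule T
      module CS = Codes S
      module CT = Codes T

    transfer : ℕ → List ℕ → List ℕ
    transfer n x = CT.decode (CS.encode n x)

    transfer-ok : ∀ {n x} → S.Ok x → length x ≡ n →
      T.Ok (transfer n x) × length (transfer n x) ≡ n × T.stat (transfer n x) ≡ S.stat x
    transfer-ok {n} {x} ok len with CS.decode-encode n x ok len
    ... | vc , de with CT.decode-valid (CS.encode n x) vc | CS.decode-valid (CS.encode n x) vc
    ... | okT , lenT , statT | _ , _ , statS =
      okT , trans lenT (CS.length-encode n x) , trans statT (trans (sym statS) (cong S.stat de))

    encode-transfer : ∀ {n x} → S.Ok x → length x ≡ n → CT.encode n (transfer n x) ≡ CS.encode n x
    encode-transfer {n} {x} ok len =
      subst (λ k → CT.encode k (transfer n x) ≡ CS.encode n x) (CS.length-encode n x)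
        (CT.encode-decode (CS.encode n x) (proj₁ (CS.decode-encode n x ok len)))

    transfer-injective : ∀ {n x y} → S.Ok x → S.Ok y → length x ≡ n → length y ≡ n →
      transfer n x ≡ transfer n y → x ≡ y
    transfer-injective {n} {x} {y} okx oky lenx leny eq = begin
        x
      ≡⟨ proj₂ (CS.decode-encode n x okx lenx) ⟨
        CS.decode (CS.encode n x)
      ≡⟨ cong CS.decode (encode-transfer okx lenx) ⟨
        CS.decode (CT.encode n (transfer n x))
      ≡⟨ cong (λ z → CS.decode (CT.encode n z)) eq ⟩
        CS.decode (CT.encode n (transfer n y))
      ≡⟨ cong CS.decode (encode-transfer oky leny) ⟩
        CS.decode (CS.encode n y)
      ≡⟨ proj₂ (CS.decode-encode n y oky leny) ⟩
        y
      ∎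
      where open ≡-Reasoning

    transfer-surjective : ∀ {n z} → T.Ok z → length z ≡ n →
      ∃ λ x → S.Ok x × length x ≡ n × transfer n x ≡ z
    transfer-surjective {n} {z} ok len with CT.decode-encode n z ok len
    ... | vc , de with CS.decode-valid cs vc
      where cs = CT.encode n z
    ... | okx , lenx , _ =
      x , okx , trans lenx (CT.length-encode n z) ,
      trans (cong CT.decode (subst (λ k → CS.encode k x ≡ cs) (CT.length-encode n z) (CS.encode-decode cs vc))) de
      where
      cs = CT.encode n z
      x = CS.decode cs

module Trees where

  open Counting
  open Growth

  -- Trees are stored newest vertex first: the list v ∷ r describes the tree
  -- r on {0,…,length r} with the vertex length r + 1 attached to v.
  Grown : List ℕ → Set
  Grown []      = ⊤
  Grown (v ∷ r) = Grown r × v ≤ length r × children r v < 2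

  withChildren : ℕ → List ℕ → List ℕ
  withChildren k r = filter (λ v → children r v ≟ k) (upTo (suc (length r)))

  nWith : ℕ → List ℕ → ℕ
  nWith k r = count (λ v → does (children r v ≟ k)) (suc (length r))

  length-withChildren : ∀ k r → length (withChildren k r) ≡ nWith k r
  length-withChildren k r = count-filter (λ v → children r v ≟ k) (λ i → i) (suc (length r))

  ∈-withChildren⁻ : ∀ {k r s} → s ∈ withChildren k r → s ≤ length r × children r s ≡ k
  ∈-withChildren⁻ {k} {r} m with ∈-filter⁻ (λ v → children r v ≟ k) m
  ... | s∈ , e = ≤-pred (∈-upTo⁻ s∈) , e

  ∈-withChildren⁺ : ∀ {k r s} → s ≤ length r → children r s ≡ k → s ∈ withChildren k r
  ∈-withChildren⁺ {k} {r} s≤ e = ∈-filter⁺ (λ v → children r v ≟ k) (∈-upTo⁺ (s≤s s≤)) e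

  children-other : ∀ s r w → w ≢ s → children (s ∷ r) w ≡ children r w
  children-other s r w w≢s = cong length (filter-reject (w ≟_) w≢s)

  children-self : ∀ s r → children (s ∷ r) s ≡ suc (children r s)
  children-self s r = cong length (filter-accept (s ≟_) refl)

  children-fresh : ∀ r w → Grown r → length r < w → children r w ≡ 0
  children-fresh []      w _ _ = refl
  children-fresh (v ∷ r) w (g , v≤ , _) r< =
    trans (children-other v r w (λ { refl → <-irrefl refl (≤-trans (s≤s v≤) (<⇒≤ r<)) }))
          (children-fresh r w g (<-trans (n<1+n _) r<))

  -- Attaching the new vertex to s (which had j children): s moves from
  -- "j children" to "j+1 children", and a new childless vertex appears.
  nWith-attach : ∀ k s r j → Grown r → s ≤ length r → children r s ≡ j →
    nWith k (s ∷ r) + bit (does (j ≟ k)) ≡ bit (does (0 ≟ k)) + (nWith k r + bit (does (suc j ≟ k)))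
  nWith-attach k s r j g s≤ e = begin
      (bit (old-or-new (suc m)) + count old-or-new (suc m)) + bit (does (j ≟ k))
    ≡⟨ cong (λ c → (bit (does (c ≟ k)) + count old-or-new (suc m)) + bit (does (j ≟ k)))
            (trans (children-other s r (suc m) (λ { refl → <-irrefl refl (s≤s s≤) })) (children-fresh r (suc m) g ≤-refl)) ⟩
      (bit (does (0 ≟ k)) + count old-or-new (suc m)) + bit (does (j ≟ k))
    ≡⟨ +-assoc (bit (does (0 ≟ k))) _ _ ⟩
      bit (does (0 ≟ k)) + (count old-or-new (suc m) + bit (does (j ≟ k)))
    ≡⟨ cong (λ c → bit (does (0 ≟ k)) + (count old-or-new (suc m) + bit (does (c ≟ k)))) (sym e) ⟩
      bit (does (0 ≟ k)) + (count old-or-new (suc m) + bit (old s))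
    ≡⟨ cong (bit (does (0 ≟ k)) +_) (count-update old-or-new old (suc m) s (s≤s s≤)
          (λ i _ i≢s → cong (λ c → does (c ≟ k)) (children-other s r i i≢s))) ⟩
      bit (does (0 ≟ k)) + (nWith k r + bit (old-or-new s))
    ≡⟨ cong (λ c → bit (does (0 ≟ k)) + (nWith k r + bit (does (c ≟ k)))) (trans (children-self s r) (cong suc e)) ⟩
      bit (does (0 ≟ k)) + (nWith k r + bit (does (suc j ≟ k)))
    ∎
    where
    open ≡-Reasoning
    m = length r
    old old-or-new : ℕ → Bool
    old v = does (children r v ≟ k)
    old-or-new v = does (children (s ∷ r) v ≟ k)

  attach-leaf : ∀ {s r} → Grown r → s ≤ length r → children r s ≡ 0 →
    nWith 0 (s ∷ r) ≡ nWith 0 r × nWith 1 (s ∷ r) ≡ suc (nWith 1 r)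
  attach-leaf {s} {r} g s≤ e =
    suc-injective (trans (+-comm 1 _) (trans (nWith-attach 0 s r 0 g s≤ e) (cong suc (+-identityʳ _)))) ,
    trans (sym (+-identityʳ _)) (trans (nWith-attach 1 s r 0 g s≤ e) (+-comm (nWith 1 r) 1))

  attach-single : ∀ {s r} → Grown r → s ≤ length r → children r s ≡ 1 →
    nWith 0 (s ∷ r) ≡ suc (nWith 0 r) × suc (nWith 1 (s ∷ r)) ≡ nWith 1 r
  attach-single {s} {r} g s≤ e =
    trans (sym (+-identityʳ _)) (trans (nWith-attach 0 s r 1 g s≤ e) (cong suc (+-identityʳ _))) ,
    trans (+-comm 1 _) (trans (nWith-attach 1 s r 1 g s≤ e) (+-identityʳ _))

  degree-balance : ∀ r → Grown r → nWith 1 r + (nWith 0 r + nWith 0 r) ≡ suc (suc (length r))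
  degree-balance []      _ = refl
  degree-balance (s ∷ r) (g , s≤ , c<) with children r s in e
  ... | 0 = let (e₀ , e₁) = attach-leaf g s≤ e in
    trans (cong₂ (λ a b → a + (b + b)) e₁ e₀) (cong suc (degree-balance r g))
  ... | 1 = let (e₀ , e₁) = attach-single g s≤ e in begin
      nWith 1 (s ∷ r) + (nWith 0 (s ∷ r) + nWith 0 (s ∷ r))
    ≡⟨ cong (λ b → nWith 1 (s ∷ r) + (b + b)) e₀ ⟩
      nWith 1 (s ∷ r) + (suc (nWith 0 r) + suc (nWith 0 r))
    ≡⟨ shift (nWith 1 (s ∷ r)) (nWith 0 r) ⟩
      suc (suc (nWith 1 (s ∷ r)) + (nWith 0 r + nWith 0 r))
    ≡⟨ cong (λ a → suc (a + (nWith 0 r + nWith 0 r))) e₁ ⟩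
      suc (nWith 1 r + (nWith 0 r + nWith 0 r))
    ≡⟨ cong suc (degree-balance r g) ⟩
      suc (suc (suc (length r)))
    ∎
    where
    open ≡-Reasoning
    shift : ∀ a b → a + (suc b + suc b) ≡ suc (suc a + (b + b))
    shift = solve-∀
  degree-balance (s ∷ r) (g , s≤ , s≤s (s≤s ())) | suc (suc _)

  leaf-count : List ℕ → ℕ
  leaf-count r = length (withChildren 0 r)

  leaf-count-keep : ∀ {r s} → Grown r → s ∈ withChildren 0 r → leaf-count (s ∷ r) ≡ leaf-count r
  leaf-count-keep {r} {s} g m with ∈-withChildren⁻ {0} {r} m
  ... | s≤ , e = trans (length-withChildren 0 (s ∷ r))
                   (trans (proj₁ (attach-leaf g s≤ e)) (sym (length-withChildren 0 r)))

  leaf-count-raise : ∀ {r s} → Grown r → s ∈ withChildren 1 r → leaf-count (s ∷ r) ≡ suc (leaf-count r)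
  leaf-count-raise {r} {s} g m with ∈-withChildren⁻ {1} {r} m
  ... | s≤ , e = trans (length-withChildren 0 (s ∷ r))
                   (trans (proj₁ (attach-single g s≤ e)) (cong suc (sym (length-withChildren 0 r))))

  site-count : ∀ {r} → Grown r → length (withChildren 1 r) + (leaf-count r + leaf-count r) ≡ suc (suc (length r))
  site-count {r} g = subst₂ (λ a b → a + (b + b) ≡ suc (suc (length r)))
    (sym (length-withChildren 1 r)) (sym (length-withChildren 0 r)) (degree-balance r g)

  site⁻ : ∀ {r s} → s ∈ withChildren 0 r ++ withChildren 1 r → s ≤ length r × children r s < 2
  site⁻ {r} m with ∈-++⁻ (withChildren 0 r) m
  ... | inj₁ m₀ = let (s≤ , e) = ∈-withChildren⁻ {0} {r} m₀ in s≤ , subst (_< 2) (sym e) (s≤s z≤n)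
  ... | inj₂ m₁ = let (s≤ , e) = ∈-withChildren⁻ {1} {r} m₁ in s≤ , subst (_< 2) (sym e) (s≤s (s≤s z≤n))

  site⁺ : ∀ {r s} → s ≤ length r → children r s < 2 → s ∈ withChildren 0 r ++ withChildren 1 r
  site⁺ {r} {s} s≤ c< with children r s in e
  ... | 0 = ∈-++⁺ˡ (∈-withChildren⁺ {0} {r} s≤ e)
  ... | 1 = ∈-++⁺ʳ (withChildren 0 r) (∈-withChildren⁺ {1} {r} s≤ e)
  site⁺ s≤ (s≤s (s≤s ())) | suc (suc _)

  vertex-sites-unique : ∀ r → Unique (withChildren 0 r ++ withChildren 1 r)
  vertex-sites-unique r = Unique.++⁺ (distinct 0) (distinct 1)
    (λ (m₀ , m₁) → 0≢1+n (trans (sym (proj₂ (∈-withChildren⁻ {0} {r} m₀))) (proj₂ (∈-withChildren⁻ {1} {r} m₁))))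
    where
    distinct : ∀ k → Unique (withChildren k r)
    distinct k = Unique.filter⁺ (λ v → children r v ≟ k) (Unique.upTo⁺ (suc (length r)))

  rest : List ℕ → List ℕ
  rest []      = []
  rest (_ ∷ r) = r

  newest : List ℕ → ℕ
  newest []      = 0
  newest (v ∷ _) = v

  treeRule : GrowthRule
  treeRule = record
    { Ok = Grown ; stat = leaf-count ; keep = withChildren 0 ; raise = withChildren 1
    ; grow = λ r v → v ∷ r ; parent = rest ; lastSite = newest
    ; ok-[] = tt ; stat-[] = refl ; length-keep = λ _ → refl
    ; site-count = site-count
    ; sites-unique = λ {r} _ → vertex-sites-unique r
    ; grow-ok = λ {r} g m → g , site⁻ {r} m
    ; grow-length = λ _ _ → refl ; parent-grow = λ _ _ → refl ; lastSite-grow = λ _ _ → refl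
    ; stat-keep = leaf-count-keep ; stat-raise = leaf-count-raise
    ; shrink = λ { {v ∷ r} (g , v≤ , c<) _ → g , site⁺ {r} v≤ c< , refl }
    }

  -- The encoding lists the parents in vertex order, i.e. it is the
  -- reverse of the newest-first list.

  children-reverse : ∀ p w → children (reverse p) w ≡ children p w
  children-reverse p w = ↭-length (filter-↭ (w ≟_) (↭-reverse p))

  ParentsBelow-snoc⁻ : ∀ k xs x → ParentsBelow k (xs ++ [ x ]) → ParentsBelow k xs × x ≤ k + length xs
  ParentsBelow-snoc⁻ k []       x (x≤ , _)  = tt , subst (x ≤_) (sym (+-identityʳ k)) x≤
  ParentsBelow-snoc⁻ k (y ∷ xs) x (y≤ , pb) with ParentsBelow-snoc⁻ (suc k) xs x pb
  ... | pb′ , x≤ = (y≤ , pb′) , subst (x ≤_) (sym (+-suc k (length xs))) x≤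

  ParentsBelow-snoc⁺ : ∀ k xs x → ParentsBelow k xs → x ≤ k + length xs → ParentsBelow k (xs ++ [ x ])
  ParentsBelow-snoc⁺ k []       x _         x≤ = subst (x ≤_) (+-identityʳ k) x≤ , tt
  ParentsBelow-snoc⁺ k (y ∷ xs) x (y≤ , pb) x≤ =
    y≤ , ParentsBelow-snoc⁺ (suc k) xs x pb (subst (x ≤_) (+-suc k (length xs)) x≤)

  children-∷ : ∀ v r w → children r w ≤ children (v ∷ r) w
  children-∷ v r w with w ≟ v
  ... | yes refl = subst (children r w ≤_) (sym (children-self w r)) (n≤1+n _)
  ... | no  w≢v  = ≤-reflexive (sym (children-other v r w w≢v))

  parents⇒grown : ∀ r → ParentsBelow 0 (reverse r) → (∀ w → children r w ≤ 2) → Grown r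
  parents⇒grown []      _  _  = tt
  parents⇒grown (v ∷ r) pb ≤2
    with ParentsBelow-snoc⁻ 0 (reverse r) v (subst (ParentsBelow 0) (unfold-reverse v r) pb)
  ... | pb′ , v≤ =
    parents⇒grown r pb′ (λ w → ≤-trans (children-∷ v r w) (≤2 w)) ,
    subst (v ≤_) (length-reverse r) v≤ ,
    subst (_≤ 2) (children-self v r) (≤2 v)

  grown⇒parents : ∀ r → Grown r → ParentsBelow 0 (reverse r) × (∀ w → children r w ≤ 2)
  grown⇒parents []      _            = tt , λ _ → z≤n
  grown⇒parents (v ∷ r) (g , v≤ , c<) with grown⇒parents r g
  ... | pb , ≤2 =
    subst (ParentsBelow 0) (sym (unfold-reverse v r))
      (ParentsBelow-snoc⁺ 0 (reverse r) v pb (subst (v ≤_) (sym (length-reverse r)) v≤)) ,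
    ≤2′
    where
    ≤2′ : ∀ w → children (v ∷ r) w ≤ 2
    ≤2′ w with w ≟ v
    ... | yes refl = subst (_≤ 2) (sym (children-self v r)) c<
    ... | no  w≢v  = subst (_≤ 2) (sym (children-other v r w w≢v)) (≤2 w)

  is12Tree⇒grown : ∀ n p → Is12Tree n p → Grown (reverse p) × length (reverse p) ≡ n
  is12Tree⇒grown n p (len , pb , ≤2) =
    parents⇒grown (reverse p) (subst (ParentsBelow 0) (sym (reverse-involutive p)) pb)
      (λ w → subst (_≤ 2) (sym (children-reverse p w)) (≤2 w)) ,
    trans (length-reverse p) len

  grown⇒is12Tree : ∀ n r → Grown r → length r ≡ n → Is12Tree n (reverse r)
  grown⇒is12Tree n r g len with grown⇒parents r g
  ... | pb , ≤2 = trans (length-reverse r) len , pb , λ w → subst (_≤ 2) (sym (children-reverse r w)) (≤2 w)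

  leaves-reverse : ∀ n p → length p ≡ n → leaves n p ≡ leaf-count (reverse p)
  leaves-reverse n p len rewrite length-reverse p | len =
    cong length (filter-≐ (λ v → children p v ≟ 0) (λ v → children (reverse p) v ≟ 0)
      ((λ e → trans (children-reverse p _) e) , (λ e → trans (sym (children-reverse p _)) e))
      (upTo (suc n)))

module Insertion where

  open Counting
  open Positions using (position)

  does-true : ∀ {A : Set} (a? : Dec A) → does a? ≡ true → A
  does-true (yes a) _ = a

  -- position i (counted from 0) of σ is a descent: σᵢ > σᵢ₊₁
  descentAt : List ℕ → ℕ → Bool
  descentAt (a ∷ l)     (suc i) = descentAt l i
  descentAt (a ∷ b ∷ l) zero    = does (b <? a)
  descentAt _           _       = false

  descentAt-bound : ∀ σ i → descentAt σ i ≡ true → suc (suc i) ≤ length σ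
  descentAt-bound (a ∷ b ∷ l) zero    _ = s≤s (s≤s z≤n)
  descentAt-bound (a ∷ l)     (suc i) e = s≤s (descentAt-bound l i e)

  descentAt-DD : ∀ σ j → descentAt σ j ≡ true → descentAt σ (suc j) ≡ true → HasDD σ
  descentAt-DD (a ∷ b ∷ c ∷ l) zero    e₁ e₂ = here (does-true (b <? a) e₁) (does-true (c <? b) e₂)
  descentAt-DD (a ∷ l)         (suc j) e₁ e₂ = there (descentAt-DD l j e₁ e₂)
  descentAt-DD (a ∷ b ∷ [])    zero    _  ()

  desFrom-∷ : ∀ a b l → desFrom a (b ∷ l) ≡ bit (does (b <? a)) + desFrom b l
  desFrom-∷ a b l with b <? a
  ... | yes b<a = sym (cong (λ p → bit p + desFrom b l) (dec-true (b <? a) b<a))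
  ... | no  b≮a = sym (cong (λ p → bit p + desFrom b l) (dec-false (b <? a) b≮a))

  des-count : ∀ σ → count (descentAt σ) (length σ) ≡ des σ
  des-count []          = refl
  des-count (a ∷ [])    = refl
  des-count (a ∷ b ∷ l) = begin
      count (descentAt (a ∷ b ∷ l)) (suc (length (b ∷ l)))
    ≡⟨ count-suc (descentAt (a ∷ b ∷ l)) (length (b ∷ l)) ⟩
      bit (does (b <? a)) + count (descentAt (b ∷ l)) (length (b ∷ l))
    ≡⟨ cong (bit (does (b <? a)) +_) (des-count (b ∷ l)) ⟩
      bit (does (b <? a)) + desFrom b l
    ≡⟨ desFrom-∷ a b l ⟨
      desFrom a (b ∷ l)
    ∎
    where open ≡-Reasoning

  -- Slots of σ are 0,…,length σ (slot i lies before σᵢ).  Inserting a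
  -- largest letter keeps the number of descents exactly at the last slot
  -- and at the slots right after a descent.
  atEnd afterDescent keepsDes : List ℕ → ℕ → Bool
  atEnd σ i = does (i ≟ length σ)
  afterDescent σ zero    = false
  afterDescent σ (suc j) = descentAt σ j
  keepsDes σ i = atEnd σ i ∨ afterDescent σ i

  insertAt : ℕ → ℕ → List ℕ → List ℕ
  insertAt zero    x l       = x ∷ l
  insertAt (suc i) x []      = x ∷ []
  insertAt (suc i) x (a ∷ l) = a ∷ insertAt i x l

  length-insertAt : ∀ x σ i → length (insertAt i x σ) ≡ suc (length σ)
  length-insertAt x σ       zero    = refl
  length-insertAt x []      (suc i) = refl
  length-insertAt x (a ∷ l) (suc i) = cong suc (length-insertAt x l i)

  insertAt-↭ : ∀ x σ i → insertAt i x σ ↭ x ∷ σ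
  insertAt-↭ x σ       zero    = ↭-refl
  insertAt-↭ x []      (suc i) = ↭-refl
  insertAt-↭ x (a ∷ l) (suc i) = ↭-trans (prep a (insertAt-↭ x l i)) (swap a x ↭-refl)

  desFrom-insertAt : ∀ x a l s → a < x → All (_< x) l → s ≤ length l →
    desFrom a (insertAt s x l) + bit (keepsDes (a ∷ l) (suc s)) ≡ suc (desFrom a l)
  desFrom-insertAt x a []      zero    a<x _           _ =
    cong (_+ 1) (trans (desFrom-∷ a x []) (cong (λ p → bit p + 0) (dec-false (x <? a) (<⇒≯ a<x))))
  desFrom-insertAt x a (b ∷ l) zero    a<x (b<x ∷ _)   _ = begin
      desFrom a (x ∷ b ∷ l) + bit (does (b <? a))
    ≡⟨ cong (_+ bit (does (b <? a))) (trans (desFrom-∷ a x (b ∷ l)) (cong₂ (λ p q → bit p + q)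
         (dec-false (x <? a) (<⇒≯ a<x)) (trans (desFrom-∷ x b l) (cong (λ p → bit p + desFrom b l) (dec-true (b <? x) b<x))))) ⟩
      suc (desFrom b l) + bit (does (b <? a))
    ≡⟨ cong suc (+-comm (desFrom b l) _) ⟩
      suc (bit (does (b <? a)) + desFrom b l)
    ≡⟨ cong suc (desFrom-∷ a b l) ⟨
      suc (desFrom a (b ∷ l))
    ∎
    where open ≡-Reasoning
  desFrom-insertAt x a (b ∷ l) (suc s) a<x (b<x ∷ l<x) (s≤s s≤) = begin
      desFrom a (b ∷ insertAt s x l) + bit (keepsDes (b ∷ l) (suc s))
    ≡⟨ cong (_+ bit (keepsDes (b ∷ l) (suc s))) (desFrom-∷ a b (insertAt s x l)) ⟩
      bit (does (b <? a)) + desFrom b (insertAt s x l) + bit (keepsDes (b ∷ l) (suc s))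
    ≡⟨ +-assoc (bit (does (b <? a))) _ _ ⟩
      bit (does (b <? a)) + (desFrom b (insertAt s x l) + bit (keepsDes (b ∷ l) (suc s)))
    ≡⟨ cong (bit (does (b <? a)) +_) (desFrom-insertAt x b l s b<x l<x s≤) ⟩
      bit (does (b <? a)) + suc (desFrom b l)
    ≡⟨ +-suc (bit (does (b <? a))) _ ⟩
      suc (bit (does (b <? a)) + desFrom b l)
    ≡⟨ cong suc (desFrom-∷ a b l) ⟨
      suc (desFrom a (b ∷ l))
    ∎
    where open ≡-Reasoning

  des-insertAt : ∀ x σ s → All (_< x) σ → s ≤ length σ →
    des (insertAt s x σ) + bit (keepsDes σ s) ≡ suc (des σ)
  des-insertAt x []      zero    _           _       = refl
  des-insertAt x (a ∷ l) zero    (a<x ∷ _)   _       =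
    trans (+-identityʳ _) (trans (desFrom-∷ x a l) (cong (λ p → bit p + desFrom a l) (dec-true (a <? x) a<x)))
  des-insertAt x (a ∷ l) (suc s) (a<x ∷ l<x) (s≤s s≤) = desFrom-insertAt x a l s a<x l<x s≤

  insertAt-DD : ∀ x σ i → All (_< x) σ → HasDD (insertAt i x σ) → HasDD σ ⊎ descentAt σ i ≡ true
  insertAt-DD-tail : ∀ x a l i → All (_< x) l → HasDD (insertAt i x l) → HasDD (a ∷ l) ⊎ descentAt (a ∷ l) (suc i) ≡ true
  insertAt-DD-tail x a l i l<x h = Data.Sum.map there (λ e → e) (insertAt-DD x l i l<x h)

  insertAt-DD x σ             zero    _         (there h)    = inj₁ h
  insertAt-DD x (b ∷ c ∷ l)   zero    _         (here _ c<b) = inj₂ (dec-true (c <? b) c<b)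
  insertAt-DD x []            (suc i)       _           (there ())
  insertAt-DD x (a ∷ l)       (suc zero)    (a<x ∷ _)   (here x<a _) = ⊥-elim (<-asym a<x x<a)
  insertAt-DD x (a ∷ l)       (suc zero)    (_ ∷ l<x)   (there h)    = insertAt-DD-tail x a l zero l<x h
  insertAt-DD x (a ∷ [])      (suc (suc i)) (_ ∷ l<x)   (there h)    = insertAt-DD-tail x a [] (suc i) l<x h
  insertAt-DD x (a ∷ b ∷ l)   (suc (suc zero)) (_ ∷ b<x ∷ _) (here _ x<b) = ⊥-elim (<-asym b<x x<b)
  insertAt-DD x (a ∷ b ∷ l)   (suc (suc zero)) (_ ∷ l<x)     (there h)    = insertAt-DD-tail x a (b ∷ l) (suc zero) l<x h
  insertAt-DD x (a ∷ b ∷ [])  (suc (suc (suc i))) (_ ∷ b<x ∷ _) (here _ x<b) = ⊥-elim (<-asym b<x x<b)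
  insertAt-DD x (a ∷ b ∷ [])  (suc (suc (suc i))) (_ ∷ l<x)     (there h)    = insertAt-DD-tail x a (b ∷ []) (suc (suc i)) l<x h
  insertAt-DD x (a ∷ b ∷ c ∷ l) (suc (suc (suc i))) _         (here b<a c<b) = inj₁ (here b<a c<b)
  insertAt-DD x (a ∷ b ∷ c ∷ l) (suc (suc (suc i))) (_ ∷ l<x) (there h)      = insertAt-DD-tail x a (b ∷ c ∷ l) (suc (suc i)) l<x h

  descentAt-insertAt-DD : ∀ x σ i → All (_< x) σ → descentAt σ i ≡ true → HasDD (insertAt i x σ)
  descentAt-insertAt-DD x (a ∷ b ∷ l) zero    (a<x ∷ _) e = here a<x (does-true (b <? a) e)
  descentAt-insertAt-DD x (a ∷ l)     (suc i) (_ ∷ l<x) e = there (descentAt-insertAt-DD x l i l<x e)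

  removeFirst : ℕ → List ℕ → List ℕ
  removeFirst x [] = []
  removeFirst x (a ∷ l) with a ≟ x
  ... | yes _ = l
  ... | no  _ = a ∷ removeFirst x l

  insertAt-removeFirst : ∀ x y → x ∈ y → insertAt (position x y) x (removeFirst x y) ≡ y
  insertAt-removeFirst x (a ∷ l) m with a ≟ x
  insertAt-removeFirst x (a ∷ l) m          | yes refl = refl
  insertAt-removeFirst x (a ∷ l) (here x≡a) | no  a≢x  = ⊥-elim (a≢x (sym x≡a))
  insertAt-removeFirst x (a ∷ l) (there m)  | no  _    = cong (a ∷_) (insertAt-removeFirst x l m)

  removeFirst-insertAt : ∀ x σ i → x ∉ σ → removeFirst x (insertAt i x σ) ≡ σ
  removeFirst-insertAt x σ       zero    _ with x ≟ x
  ... | yes _   = refl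
  ... | no  x≢x = ⊥-elim (x≢x refl)
  removeFirst-insertAt x []      (suc i) _ with x ≟ x
  ... | yes _   = refl
  ... | no  x≢x = ⊥-elim (x≢x refl)
  removeFirst-insertAt x (a ∷ l) (suc i) x∉ with a ≟ x
  ... | yes refl = ⊥-elim (x∉ (here refl))
  ... | no  _    = cong (a ∷_) (removeFirst-insertAt x l i (λ m → x∉ (there m)))

  position-insertAt : ∀ x σ i → x ∉ σ → i ≤ length σ → position x (insertAt i x σ) ≡ i
  position-insertAt x σ       zero    _  _ with x ≟ x
  ... | yes _   = refl
  ... | no  x≢x = ⊥-elim (x≢x refl)
  position-insertAt x (a ∷ l) (suc i) x∉ (s≤s i≤) with a ≟ x
  ... | yes refl = ⊥-elim (x∉ (here refl))
  ... | no  _    = cong suc (position-insertAt x l i (λ m → x∉ (there m)) i≤)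

  removeFirst-↭ : ∀ x y → x ∈ y → y ↭ x ∷ removeFirst x y
  removeFirst-↭ x (a ∷ l) m with a ≟ x
  removeFirst-↭ x (a ∷ l) m          | yes refl = ↭-refl
  removeFirst-↭ x (a ∷ l) (here x≡a) | no  a≢x  = ⊥-elim (a≢x (sym x≡a))
  removeFirst-↭ x (a ∷ l) (there m)  | no  _    = ↭-trans (prep a (removeFirst-↭ x l m)) (swap a x ↭-refl)

  module _ {P : ℕ → Set} (P? : Decidable P) where

    filter-∷-cong : ∀ a {xs ys} → filter P? xs ≡ filter P? ys → filter P? (a ∷ xs) ≡ filter P? (a ∷ ys)
    filter-∷-cong a e with does (P? a)
    ... | true  = cong (a ∷_) e
    ... | false = e

    filter-insertAt : ∀ x σ i → ¬ P x → filter P? (insertAt i x σ) ≡ filter P? σ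
    filter-insertAt x σ       zero    ¬Px = filter-reject P? ¬Px
    filter-insertAt x []      (suc i) ¬Px = filter-reject P? ¬Px
    filter-insertAt x (a ∷ l) (suc i) ¬Px = filter-∷-cong a (filter-insertAt x l i ¬Px)

    filter-removeFirst : ∀ x y → ¬ P x → filter P? (removeFirst x y) ≡ filter P? y
    filter-removeFirst x []      ¬Px = refl
    filter-removeFirst x (a ∷ l) ¬Px with a ≟ x
    ... | yes refl = sym (filter-reject P? ¬Px)
    ... | no  _    = filter-∷-cong a (filter-removeFirst x l ¬Px)

module Slots where

  open Counting
  open Insertion

  -- Slot i of σ is bad when it is the top of a descent (inserting a
  -- largest letter there creates a double descent), and raises the number
  -- of descents when it neither keeps it nor is bad.
  raisesDes : List ℕ → ℕ → Bool
  raisesDes σ i = not (keepsDes σ i) ∧ not (descentAt σ i)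

  atEnd-true : ∀ σ i → atEnd σ i ≡ true → i ≡ length σ
  atEnd-true σ i = does-true (i ≟ length σ)

  descentAt-end : ∀ σ j → length σ ≤ suc j → descentAt σ j ≡ false
  descentAt-end σ j σ≤ with descentAt σ j in e
  ... | false = refl
  ... | true  = ⊥-elim (<-irrefl refl (≤-trans (descentAt-bound σ j e) σ≤))

  afterDescent-end : ∀ σ → afterDescent σ (length σ) ≡ false
  afterDescent-end []      = refl
  afterDescent-end (a ∷ l) = descentAt-end (a ∷ l) (length l) ≤-refl

  ∨-true : ∀ p q → p ∨ q ≡ true → p ≡ true ⊎ q ≡ true
  ∨-true true  q _ = inj₁ refl
  ∨-true false q e = inj₂ e

  ∧-false : ∀ p q → (p ≡ true → q ≡ true → ⊥) → p ∧ q ≡ false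
  ∧-false true  true  h = ⊥-elim (h refl refl)
  ∧-false true  false _ = refl
  ∧-false false q     _ = refl

  false≢true : false ≢ true
  false≢true ()

  keeps-not-bad : ∀ σ i → ¬ HasDD σ → keepsDes σ i ≡ true → descentAt σ i ≡ true → ⊥
  keeps-not-bad σ i noDD k d with ∨-true (atEnd σ i) (afterDescent σ i) k
  ... | inj₁ e = false≢true (trans (sym (descentAt-end σ i (subst (_≤ suc i) (atEnd-true σ i e) (n≤1+n i)))) d)
  keeps-not-bad σ (suc j) noDD k d | inj₂ e = noDD (descentAt-DD σ j e d)

  keep-count : ∀ σ → count (keepsDes σ) (suc (length σ)) ≡ suc (des σ)
  keep-count σ = begin
      count (keepsDes σ) (suc m)
    ≡⟨ +-identityʳ _ ⟨
      count (keepsDes σ) (suc m) + 0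
    ≡⟨ cong (count (keepsDes σ) (suc m) +_) both ⟨
      count (keepsDes σ) (suc m) + count (λ i → atEnd σ i ∧ afterDescent σ i) (suc m)
    ≡⟨ count-∨ (atEnd σ) (afterDescent σ) (suc m) ⟩
      count (atEnd σ) (suc m) + count (afterDescent σ) (suc m)
    ≡⟨ cong₂ _+_ ends (trans (count-suc (afterDescent σ) m) (des-count σ)) ⟩
      suc (des σ)
    ∎
    where
    open ≡-Reasoning
    m = length σ
    both : count (λ i → atEnd σ i ∧ afterDescent σ i) (suc m) ≡ 0
    both = count-none _ (suc m) λ i _ → ∧-false _ _ λ e₁ e₂ →
      false≢true (trans (sym (afterDescent-end σ)) (subst (λ k → afterDescent σ k ≡ true) (atEnd-true σ i e₁) e₂))
    ends : count (atEnd σ) (suc m) ≡ 1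
    ends = cong₂ _+_ (cong bit (dec-true (m ≟ m) refl))
             (count-none (atEnd σ) m λ i i<m → dec-false (i ≟ m) (<⇒≢ i<m))

  bad-count : ∀ σ → count (descentAt σ) (suc (length σ)) ≡ des σ
  bad-count σ = cong₂ _+_ (cong bit (descentAt-end σ (length σ) (n≤1+n _))) (des-count σ)

  raise-count : ∀ σ → ¬ HasDD σ →
    count (raisesDes σ) (suc (length σ)) + (suc (des σ) + suc (des σ)) ≡ suc (suc (length σ))
  raise-count σ noDD = begin
      count (raisesDes σ) (suc m) + (suc d + suc d)
    ≡⟨ cong (count (raisesDes σ) (suc m) +_) (+-suc (suc d) d) ⟩
      count (raisesDes σ) (suc m) + suc (suc d + d)
    ≡⟨ +-suc _ _ ⟩
      suc (count (raisesDes σ) (suc m) + (suc d + d))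
    ≡⟨ cong (λ z → suc (count (raisesDes σ) (suc m) + z)) (cong₂ _+_ (keep-count σ) (bad-count σ)) ⟨
      suc (count (raisesDes σ) (suc m) + (count (keepsDes σ) (suc m) + count (descentAt σ) (suc m)))
    ≡⟨ cong suc (count-neither (keepsDes σ) (descentAt σ) (suc m)) ⟩
      suc (suc m + count (λ i → keepsDes σ i ∧ descentAt σ i) (suc m))
    ≡⟨ cong (λ z → suc (suc m + z)) keep-and-bad ⟩
      suc (suc m + 0)
    ≡⟨ cong suc (+-identityʳ _) ⟩
      suc (suc m)
    ∎
    where
    open ≡-Reasoning
    d = des σ
    m = length σ
    keep-and-bad : count (λ i → keepsDes σ i ∧ descentAt σ i) (suc m) ≡ 0
    keep-and-bad = count-none _ (suc m) λ i _ → ∧-false _ _ (keeps-not-bad σ i noDD)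

module SimsunPermutations where

  open Counting
  open Growth
  open Insertion
  open Slots
  open Positions using (position; position-<)

  oneTo-suc : ∀ m → oneTo (suc m) ≡ oneTo m ++ [ suc m ]
  oneTo-suc m = trans (cong (map suc) (sym (upTo-∷ʳ m))) (map-++ suc (upTo m) [ m ])

  oneTo-suc-↭ : ∀ m → oneTo (suc m) ↭ suc m ∷ oneTo m
  oneTo-suc-↭ m = subst (_↭ suc m ∷ oneTo m) (sym (oneTo-suc m)) (↭-sym (∷↭∷ʳ (suc m) (oneTo m)))

  perm-length : ∀ {m σ} → IsPerm m σ → length σ ≡ m
  perm-length {m} p = trans (↭-length p) (trans (length-map suc (upTo m)) (length-upTo m))

  perm-bound : ∀ {m σ} → IsPerm m σ → All (_≤ m) σ
  perm-bound {m} p = All-resp-↭ (↭-sym p) (All.tabulate bound)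
    where
    bound : ∀ {x} → x ∈ oneTo m → x ≤ m
    bound x∈ with ∈-map⁻ suc x∈
    ... | i , i∈ , refl = ∈-upTo⁻ i∈

  top∉ : ∀ {m σ} → IsPerm m σ → suc m ∉ σ
  top∉ p x∈ = <-irrefl refl (All.lookup (perm-bound p) x∈)

  restrict-all : ∀ {k σ} → All (_≤ k) σ → restrict k σ ≡ σ
  restrict-all {k} = filter-all (_≤? k)

  simsun-noDD : ∀ {m σ} → IsPerm m σ → Simsun σ → ¬ HasDD σ
  simsun-noDD {m} p ss h = ss m (subst HasDD (sym (restrict-all (perm-bound p))) h)

  -- Restrictions to {1,…,k} with k ≥ m+1 see the whole word; the smaller
  -- ones do not see the letter m+1 at all.
  simsun-insertAt : ∀ {m σ s} → IsPerm m σ → Simsun σ → descentAt σ s ≡ false →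
    Simsun (insertAt s (suc m) σ)
  simsun-insertAt {m} {σ} {s} p ss good k h with k <? suc m
  ... | yes k<x = ss k (subst HasDD (filter-insertAt (_≤? k) (suc m) σ s (<⇒≱ k<x)) h)
  ... | no  k≮x with insertAt-DD (suc m) σ s (All.map s≤s (perm-bound p)) (subst HasDD (restrict-all all≤k) h)
    where
    all≤k : All (_≤ k) (insertAt s (suc m) σ)
    all≤k = All-resp-↭ (↭-sym (insertAt-↭ (suc m) σ s))
              (≮⇒≥ k≮x ∷ All.map (λ i≤m → ≤-trans (m≤n⇒m≤1+n i≤m) (≮⇒≥ k≮x)) (perm-bound p))
  ... | inj₁ dd  = simsun-noDD p ss dd
  ... | inj₂ bad = false≢true (trans (sym good) bad)

  simsun-removeFirst : ∀ {m y} → IsPerm m (removeFirst (suc m) y) → Simsun y → Simsun (removeFirst (suc m) y)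
  simsun-removeFirst {m} {y} p ss k h with k <? suc m
  ... | yes k<x = ss k (subst HasDD (filter-removeFirst (_≤? k) (suc m) y (<⇒≱ k<x)) h)
  ... | no  k≮x = ss m (subst HasDD (filter-removeFirst (_≤? m) (suc m) y (<-irrefl refl))
                    (subst HasDD (trans (restrict-all (All.map (λ i≤m → ≤-trans i≤m (≤-trans (n≤1+n m) (≮⇒≥ k≮x))) (perm-bound p)))
                                        (sym (restrict-all (perm-bound p)))) h))

  slotsWhere : (ℕ → Bool) → ℕ → List ℕ
  slotsWhere f m = filter (λ i → T? (f i)) (upTo (suc m))

  ∈-slotsWhere⁻ : ∀ {f m s} → s ∈ slotsWhere f m → s ≤ m × f s ≡ true
  ∈-slotsWhere⁻ {f} m∈ with ∈-filter⁻ (λ i → T? (f i)) m∈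
  ... | s∈ , t = ≤-pred (∈-upTo⁻ s∈) , Equivalence.to T-≡ t

  ∈-slotsWhere⁺ : ∀ {f m s} → s ≤ m → f s ≡ true → s ∈ slotsWhere f m
  ∈-slotsWhere⁺ {f} s≤ e = ∈-filter⁺ (λ i → T? (f i)) (∈-upTo⁺ (s≤s s≤)) (Equivalence.from T-≡ e)

  length-slotsWhere : ∀ f m → length (slotsWhere f m) ≡ count f (suc m)
  length-slotsWhere f m = count-filter (λ i → T? (f i)) (λ i → i) (suc m)

  unique-slotsWhere : ∀ f m → Unique (slotsWhere f m)
  unique-slotsWhere f m = Unique.filter⁺ (λ i → T? (f i)) (Unique.upTo⁺ (suc m))

  keepSlots raiseSlots : List ℕ → List ℕ
  keepSlots  σ = slotsWhere (keepsDes σ) (length σ)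
  raiseSlots σ = slotsWhere (raisesDes σ) (length σ)

  SimsunPerm : List ℕ → Set
  SimsunPerm σ = IsPerm (length σ) σ × Simsun σ

  slot⁻ : ∀ {σ s} → SimsunPerm σ → s ∈ keepSlots σ ++ raiseSlots σ → s ≤ length σ × descentAt σ s ≡ false
  slot⁻ {σ} {s} (p , ss) m∈ with ∈-++⁻ (keepSlots σ) m∈
  ... | inj₁ k∈ with ∈-slotsWhere⁻ {keepsDes σ} k∈
  ...   | s≤ , k = s≤ , not-bad
    where
    not-bad : descentAt σ s ≡ false
    not-bad with descentAt σ s in e
    ... | false = refl
    ... | true  = ⊥-elim (keeps-not-bad σ s (simsun-noDD p ss) k e)
  slot⁻ {σ} {s} _ m∈ | inj₂ r∈ with ∈-slotsWhere⁻ {raisesDes σ} r∈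
  ...   | s≤ , r = s≤ , not-bad (keepsDes σ s) (descentAt σ s) r
    where
    not-bad : ∀ u b → not u ∧ not b ≡ true → b ≡ false
    not-bad false false _ = refl

  slot⁺ : ∀ {σ s} → s ≤ length σ → descentAt σ s ≡ false → s ∈ keepSlots σ ++ raiseSlots σ
  slot⁺ {σ} {s} s≤ good with keepsDes σ s in k
  ... | true  = ∈-++⁺ˡ (∈-slotsWhere⁺ {keepsDes σ} s≤ k)
  ... | false = ∈-++⁺ʳ (keepSlots σ) (∈-slotsWhere⁺ {raisesDes σ} s≤ (cong₂ (λ u b → not u ∧ not b) k good))

  slots-unique : ∀ σ → Unique (keepSlots σ ++ raiseSlots σ)
  slots-unique σ = Unique.++⁺ (unique-slotsWhere (keepsDes σ) (length σ)) (unique-slotsWhere (raisesDes σ) (length σ))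
    λ {s} (k∈ , r∈) → disjoint (keepsDes σ s) (descentAt σ s)
      (proj₂ (∈-slotsWhere⁻ {keepsDes σ} k∈)) (proj₂ (∈-slotsWhere⁻ {raisesDes σ} r∈))
    where
    disjoint : ∀ u b → u ≡ true → not u ∧ not b ≡ true → ⊥
    disjoint true b _ ()

  insertTop : List ℕ → ℕ → List ℕ
  insertTop σ s = insertAt s (suc (length σ)) σ

  removeTop : List ℕ → List ℕ
  removeTop y = removeFirst (length y) y

  topSlot : List ℕ → ℕ
  topSlot y = position (length y) y

  insertTop-perm : ∀ {σ} s → IsPerm (length σ) σ → IsPerm (length (insertTop σ s)) (insertTop σ s)
  insertTop-perm {σ} s p rewrite length-insertAt (suc (length σ)) σ s =
    ↭-trans (insertAt-↭ (suc m) σ s) (↭-trans (prep (suc m) p) (↭-sym (oneTo-suc-↭ m)))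
    where m = length σ

  insertTop-ok : ∀ {σ s} → SimsunPerm σ → s ∈ keepSlots σ ++ raiseSlots σ → SimsunPerm (insertTop σ s)
  insertTop-ok {σ} {s} ok@(p , ss) s∈ = insertTop-perm s p , simsun-insertAt p ss (proj₂ (slot⁻ ok s∈))

  des-insertTop : ∀ {σ s} → SimsunPerm σ → s ≤ length σ →
    des (insertTop σ s) + bit (keepsDes σ s) ≡ suc (des σ)
  des-insertTop {σ} {s} (p , _) s≤ = des-insertAt (suc (length σ)) σ s (All.map s≤s (perm-bound p)) s≤

  des-keep : ∀ {σ s} → SimsunPerm σ → s ∈ keepSlots σ → suc (des (insertTop σ s)) ≡ suc (des σ)
  des-keep {σ} {s} ok k∈ with ∈-slotsWhere⁻ {keepsDes σ} k∈
  ... | s≤ , k = trans (+-comm 1 _) (subst (λ b → des (insertTop σ s) + bit b ≡ suc (des σ)) k (des-insertTop ok s≤))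

  des-raise : ∀ {σ s} → SimsunPerm σ → s ∈ raiseSlots σ → suc (des (insertTop σ s)) ≡ suc (suc (des σ))
  des-raise {σ} {s} ok r∈ with ∈-slotsWhere⁻ {raisesDes σ} r∈
  ... | s≤ , r = cong suc (trans (sym (+-identityʳ _))
                   (subst (λ b → des (insertTop σ s) + bit b ≡ suc (des σ)) (not-keeping (keepsDes σ s) _ r) (des-insertTop ok s≤)))
    where
    not-keeping : ∀ u b → not u ∧ not b ≡ true → u ≡ false
    not-keeping false b _ = refl

  removeTop-shrink : ∀ {y} → SimsunPerm y → 0 < length y →
    SimsunPerm (removeTop y) × topSlot y ∈ keepSlots (removeTop y) ++ raiseSlots (removeTop y) ×
    insertTop (removeTop y) (topSlot y) ≡ y
  removeTop-shrink {a ∷ l} (p , ss) _ = (pσ′ , simsun-removeFirst {m} {a ∷ l} pσ ss) , slot⁺ {σ} s≤ good , regrow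
    where
    m = length l
    x = suc m
    σ = removeFirst x (a ∷ l)
    s = position x (a ∷ l)
    x∈ : x ∈ a ∷ l
    x∈ = ∈-resp-↭ (↭-sym p) (∈-map⁺ suc (∈-upTo⁺ ≤-refl))
    split : a ∷ l ↭ x ∷ σ
    split = removeFirst-↭ x (a ∷ l) x∈
    pσ : IsPerm m σ
    pσ = drop-∷ (↭-trans (↭-sym split) (↭-trans p (oneTo-suc-↭ m)))
    lenσ : length σ ≡ m
    lenσ = perm-length pσ
    pσ′ : IsPerm (length σ) σ
    pσ′ = subst (λ k → IsPerm k σ) (sym lenσ) pσ
    s≤ : s ≤ length σ
    s≤ = subst (s ≤_) (sym lenσ) (≤-pred (position-< (a ∷ l) x∈))
    good : descentAt σ s ≡ false
    good with descentAt σ s in e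
    ... | false = refl
    ... | true  = ⊥-elim (simsun-noDD p ss (subst HasDD (insertAt-removeFirst x (a ∷ l) x∈)
                    (descentAt-insertAt-DD x σ s (All.map s≤s (perm-bound pσ)) e)))
    regrow : insertTop σ s ≡ a ∷ l
    regrow = trans (cong (λ k → insertAt s (suc k) σ) lenσ) (insertAt-removeFirst x (a ∷ l) x∈)

  simsunRule : GrowthRule
  simsunRule = record
    { Ok = SimsunPerm ; stat = λ σ → suc (des σ) ; keep = keepSlots ; raise = raiseSlots
    ; grow = insertTop ; parent = removeTop ; lastSite = topSlot
    ; ok-[] = ↭-refl , (λ k ()) ; stat-[] = refl
    ; length-keep = λ {σ} _ → trans (length-slotsWhere (keepsDes σ) (length σ)) (keep-count σ)
    ; site-count = λ {σ} (p , ss) → trans (cong (_+ (suc (des σ) + suc (des σ))) (length-slotsWhere (raisesDes σ) (length σ)))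
                                      (raise-count σ (simsun-noDD p ss))
    ; sites-unique = λ {σ} _ → slots-unique σ
    ; grow-ok = insertTop-ok
    ; grow-length = λ {σ} {s} _ _ → length-insertAt (suc (length σ)) σ s
    ; parent-grow = λ {σ} {s} (p , _) _ →
        subst (λ k → removeFirst k (insertTop σ s) ≡ σ) (sym (length-insertAt (suc (length σ)) σ s))
          (removeFirst-insertAt (suc (length σ)) σ s (top∉ p))
    ; lastSite-grow = λ {σ} {s} ok@(p , _) s∈ →
        subst (λ k → position k (insertTop σ s) ≡ s) (sym (length-insertAt (suc (length σ)) σ s))
          (position-insertAt (suc (length σ)) σ s (top∉ p) (proj₁ (slot⁻ ok s∈)))
    ; stat-keep = des-keep ; stat-raise = des-raise
    ; shrink = removeTop-shrink
    }

open Trees using (is12Tree⇒grown; grown⇒is12Tree; leaves-reverse; treeRule)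
open SimsunPermutations using (perm-length; simsunRule)
open Growth.Transfer treeRule simsunRule

-- φ reads the parent list newest vertex first, records the sites chosen
-- while growing the tree, and replays them on simsun permutations.
theorem2p1 : (n : ℕ) → 1 ≤ n →
  Σ (List ℕ → List ℕ) λ φ →
    ((p : List ℕ) → Is12Tree n p → IsPerm n (φ p) × Simsun (φ p))
    × ((p q : List ℕ) → Is12Tree n p → Is12Tree n q → φ p ≡ φ q → p ≡ q)
    × ((σ : List ℕ) → IsPerm n σ → Simsun σ → ∃ λ p → Is12Tree n p × φ p ≡ σ)
    × ((p : List ℕ) (k : ℕ) → Is12Tree n p → leaves n p ≡ suc k → des (φ p) ≡ k)
theorem2p1 n _ = φ , lands , injective , surjective , descents
  where
  φ : List ℕ → List ℕ
  φ p = transfer n (reverse p)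

  lands : (p : List ℕ) → Is12Tree n p → IsPerm n (φ p) × Simsun (φ p)
  lands p t with is12Tree⇒grown n p t
  ... | g , len with transfer-ok g len
  ...   | (perm , ss) , len′ , _ = subst (λ k → IsPerm k (φ p)) len′ perm , ss

  injective : (p q : List ℕ) → Is12Tree n p → Is12Tree n q → φ p ≡ φ q → p ≡ q
  injective p q tp tq eq with is12Tree⇒grown n p tp | is12Tree⇒grown n q tq
  ... | gp , lenp | gq , lenq = reverse-injective (transfer-injective gp gq lenp lenq eq)

  surjective : (σ : List ℕ) → IsPerm n σ → Simsun σ → ∃ λ p → Is12Tree n p × φ p ≡ σ
  surjective σ perm ss with transfer-surjective (subst (λ k → IsPerm k σ) (sym (perm-length perm)) perm , ss) (perm-length perm)
  ... | r , g , len , eq = reverse r , grown⇒is12Tree n r g len , trans (cong (transfer n) (reverse-involutive r)) eq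

  descents : (p : List ℕ) (k : ℕ) → Is12Tree n p → leaves n p ≡ suc k → des (φ p) ≡ k
  descents p k t lv with is12Tree⇒grown n p t
  ... | g , len = suc-injective (trans (proj₂ (proj₂ (transfer-ok g len)))
                    (trans (sym (leaves-reverse n p (proj₁ t))) lv))
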